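{- There exists a closed generic theory which is not generic.
   Context: Fix a nonempty set of symbols called propositional atoms and a symbol $\mathrm{K}$ which is not a propositional atom. Formulas are defined recursively: every propositional atom is a formula; if $\varphi,\psi$ are formulas then so are $\neg\varphi$, $(\varphi\wedge\psi)$, $(\varphi\vee\psi)$, $(\varphi\rightarrow\psi)$; if $\varphi$ is a formula then so is $\mathrm{K}(\varphi)$. A formula is basic if it is a propositional atom or of the form $\mathrm{K}\varphi$. A theory is a set of formulas. A model is a function assigning a truth value to every basic formula; truth $\mathscr M\models\varphi$ of an arbitrary formula is defined from the values of basic formulas by the classical truth tables (formulas $\mathrm{K}\varphi$ are treated like atoms). $\mathscr M\models T$ means $\mathscr M\models\varphi$ for all $\varphi\in T$; $T\models\varphi$ means every model of $T$ satisfies $\varphi$. A theory $T$ is closed if $\varphi\in T$ implies $\mathrm{K}\varphi\in T$. For a theory $T$ and a set $S$ of propositional atoms, $\mathscr M_{T,S}$ is the model with $\mathscr M_{T,S}\models p$ iff $p\in S$ for atoms $p$, and $\mathscr M_{T,S}\models\mathrm{K}\varphi$ iff $T\models\varphi$. A theory $T$ is generic if for every set $S$ of propositional atoms and every theory $T'\supseteq T$, $\mathscr M_{T',S}\models T$; $T$ is closed generic if for every set $S$ of propositional atoms and every closed theory $T'\supseteq T$, $\mathscr M_{T',S}\models T$. -}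

module Defs where

open import Data.Bool using (Bool; true; false; not; _∧_; _∨_)
open import Relation.Binary.PropositionalEquality using (_≡_)
open import Relation.Unary using (Pred; _∈_; _⊆_)
open import Level using (0ℓ)
open import Data.Product using (_×_)

data Formula (A : Set) : Set where
  atom : A → Formula A
  ¬'_  : Formula A → Formula A
  _∧'_ : Formula A → Formula A → Formula A
  _∨'_ : Formula A → Formula A → Formula A
  _⇒'_ : Formula A → Formula A → Formula A
  K    : Formula A → Formula A

Theory : Set → Set₁
Theory A = Pred (Formula A) 0ℓ

-- A model assigns a truth value to every basic formula: to every atom p
-- and to every formula of the form K φ (given by φ).
record Model (A : Set) : Set where
  field
    atomVal : A → Bool
    kVal    : Formula A → Bool
open Model public

eval : {A : Set} → Model A → Formula A → Bool
eval M (atom p)  = atomVal M p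
eval M (¬' φ)    = not (eval M φ)
eval M (φ ∧' ψ)  = eval M φ ∧ eval M ψ
eval M (φ ∨' ψ)  = eval M φ ∨ eval M ψ
eval M (φ ⇒' ψ)  = not (eval M φ) ∨ eval M ψ
eval M (K φ)     = kVal M φ

_⊨_ : {A : Set} → Model A → Formula A → Set
M ⊨ φ = eval M φ ≡ true

_⊨T_ : {A : Set} → Model A → Theory A → Set
M ⊨T T = ∀ φ → φ ∈ T → M ⊨ φ

_⊩_ : {A : Set} → Theory A → Formula A → Set
_⊩_ {A} T φ = (M : Model A) → M ⊨T T → M ⊨ φ

Closed : {A : Set} → Theory A → Set
Closed T = ∀ φ → φ ∈ T → K φ ∈ T

AtomSet : Set → Set
AtomSet A = A → Bool

-- "M is the model M_{T,S}": atoms true exactly on S, K φ true iff T ⊨ φ.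
-- (Since T ⊨ φ is not decidable constructively, M_{T,S} is specified
--  relationally; classically it exists and is unique.)
IsM : {A : Set} → Theory A → AtomSet A → Model A → Set
IsM {A} T S M =
  ((p : A) → atomVal M p ≡ S p) × ((φ : Formula A) → (kVal M φ ≡ true → T ⊩ φ) × (T ⊩ φ → kVal M φ ≡ true))

Generic : {A : Set} → Theory A → Set₁
Generic {A} T =
  (S : AtomSet A) (T' : Theory A) → T ⊆ T' → (M : Model A) → IsM T' S M → M ⊨T T

ClosedGeneric : {A : Set} → Theory A → Set₁
ClosedGeneric {A} T =
  (S : AtomSet A) (T' : Theory A) → T ⊆ T' → Closed T' → (M : Model A) → IsM T' S M → M ⊨T T

{-# OPTIONS --safe #-}
module Submission where

-- Take T = {p ∨ ¬p, KK(p ∨ ¬p)}. Over a closed T' ⊇ T, K(p ∨ ¬p) ∈ T', so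
-- M_{T',S} makes KK(p ∨ ¬p) true. But a generic theory may only assert K χ
-- when χ follows from it: take T' to be the complete theory of a model N of T;
-- then M_{T',S} ⊨ K χ iff N ⊨ χ. A model of T in which K(p ∨ ¬p) is false
-- therefore refutes genericity.

open import Defs
open import Data.Bool using (true; false; not)
open import Data.Bool.Properties using (∨-inverseʳ; not-injective)
open import Data.Product using (Σ; _×_; _,_; proj₂)
open import Data.Sum using (_⊎_; inj₁; inj₂)
open import Relation.Nullary using (¬_)
open import Relation.Binary.PropositionalEquality using (_≡_; refl; trans; cong)
open import Relation.Unary using (_∈_)

module _ {A : Set} where

  excludedMiddle : (M : Model A) (φ : Formula A) → M ⊨ (φ ∨' (¬' φ))
  excludedMiddle M φ = ∨-inverseʳ (eval M φ)

  IsM-member⇒K : ∀ {T S M} {φ : Formula A} → IsM T S M → φ ∈ T → M ⊨ K φ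
  IsM-member⇒K (_ , kVal-spec) φ∈T =
    proj₂ (kVal-spec _) (λ N N⊨T → N⊨T _ φ∈T)

  Th : Model A → Theory A
  Th M φ = M ⊨ φ

  ⊨Th⇒eval≡ : ∀ {M N} → N ⊨T Th M → (φ : Formula A) → eval N φ ≡ eval M φ
  ⊨Th⇒eval≡ {M} {N} N⊨ThM φ with eval M φ in eq
  ... | true  = N⊨ThM φ eq
  ... | false = not-injective (N⊨ThM (¬' φ) (cong not eq))

  M[Th_,_] : Model A → AtomSet A → Model A
  M[Th N , S ] = record { atomVal = S ; kVal = eval N }

  IsM-Th : (N : Model A) (S : AtomSet A) → IsM (Th N) S M[Th N , S ]
  IsM-Th N S = (λ _ → refl) , λ φ →
    (λ N⊨φ N′ N′⊨ThN → trans (⊨Th⇒eval≡ N′⊨ThN φ) N⊨φ) ,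
    (λ ThN⊩φ → ThN⊩φ N (λ _ N⊨ψ → N⊨ψ))

  Generic⇒K-sound : ∀ {T} {χ : Formula A} → Generic T → K χ ∈ T → T ⊩ χ
  Generic⇒K-sound {χ = χ} generic Kχ∈T N N⊨T =
    generic S (Th N) (N⊨T _) M[Th N , S ] (IsM-Th N S) (K χ) Kχ∈T
    where S = atomVal N

module _ {A : Set} (a : A) where

  ⊤' : Formula A
  ⊤' = atom a ∨' (¬' atom a)

  T : Theory A
  T φ = (φ ≡ ⊤') ⊎ (φ ≡ K (K ⊤'))

  T-closedGeneric : ClosedGeneric T
  T-closedGeneric _ _ _ _ M _ _ (inj₁ refl) = excludedMiddle M (atom a)
  T-closedGeneric _ _ T⊆T' closed _ isM _ (inj₂ refl) =
    IsM-member⇒K isM (closed ⊤' (T⊆T' (inj₁ refl)))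

  N : Model A
  N = record { atomVal = λ _ → true ; kVal = λ { (K _) → true ; _ → false } }

  N⊨T : N ⊨T T
  N⊨T _ (inj₁ refl) = excludedMiddle N (atom a)
  N⊨T _ (inj₂ refl) = refl

  T-¬generic : ¬ Generic T
  T-¬generic generic with Generic⇒K-sound generic (inj₂ refl) N N⊨T
  ... | ()

corollary23 : (A : Set) → A → Σ (Theory A) (λ T → ClosedGeneric T × ¬ Generic T)
corollary23 A a = T a , T-closedGeneric a , T-¬generic a
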